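{- Let $G$ be a finite simple $(P_2\cup P_4,\ \text{diamond})$-free graph with $\omega=\omega(G)\ge 4$. Let $A$ be a maximum clique of $G$, let $H=G-A$ be nonempty, and let $k=\omega(H)$ be the clique number of $H$. Then $\chi(G)\le\max\{2k,\omega\}$.
   Context: $P_2\cup P_4$ is the disjoint union of a path on 2 vertices and a path on 4 vertices; the diamond is $K_4$ minus one edge; $H$-free means no induced subgraph isomorphic to $H$. $\chi$ and $\omega$ denote chromatic number and clique number; $G-A$ is the graph obtained by deleting the vertices of $A$. -}

module Defs where

open import Data.Nat using (ℕ; _≤_; _⊔_; _*_)
open import Data.Fin using (Fin; toℕ)
open import Data.Fin.Subset using (Subset; _∈_; _∉_; ∣_∣)
open import Data.Bool using (Bool; true; false; T; _∨_; _∧_)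
open import Data.Product using (Σ; _×_; _,_)
open import Relation.Binary.PropositionalEquality using (_≡_; _≢_)
open import Relation.Nullary using (¬_)
open import Function.Definitions using (Injective)

record Graph (n : ℕ) : Set where
  field
    adj    : Fin n → Fin n → Bool
    sym    : ∀ x y → adj x y ≡ adj y x
    irrefl : ∀ x → adj x x ≡ false
open Graph public

Adj : ∀ {n} → Graph n → Fin n → Fin n → Set
Adj G x y = T (adj G x y)

InducedSub : ∀ {m n} → (Fin m → Fin m → Bool) → Graph n → Set
InducedSub {m} {n} h G =
  Σ (Fin m → Fin n) λ f → Injective _≡_ _≡_ f × (∀ x y → adj G (f x) (f y) ≡ h x y)

Free : ∀ {m n} → (Fin m → Fin m → Bool) → Graph n → Set
Free h G = ¬ InducedSub h G

_==_ : ℕ → ℕ → Bool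
ℕ.zero == ℕ.zero = true
ℕ.zero == ℕ.suc _ = false
ℕ.suc _ == ℕ.zero = false
ℕ.suc a == ℕ.suc b = a == b

edge : ∀ {m} → ℕ → ℕ → Fin m → Fin m → Bool
edge a b x y = ((toℕ x == a) ∧ (toℕ y == b)) ∨ ((toℕ x == b) ∧ (toℕ y == a))

P2∪P4 : Fin 6 → Fin 6 → Bool
P2∪P4 x y = edge 0 1 x y ∨ edge 2 3 x y ∨ edge 3 4 x y ∨ edge 4 5 x y

-- Diamond (K4 minus the edge 2-3) on vertices 0..3:
-- edges 0-1, 0-2, 0-3, 1-2, 1-3.
Diamond : Fin 4 → Fin 4 → Bool
Diamond x y = edge 0 1 x y ∨ edge 0 2 x y ∨ edge 0 3 x y ∨ edge 1 2 x y ∨ edge 1 3 x y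

IsClique : ∀ {n} → Graph n → Subset n → Set
IsClique G S = ∀ x y → x ∈ S → y ∈ S → x ≢ y → Adj G x y

CliqueNumberOn : ∀ {n} → Graph n → Subset n → ℕ → Set
CliqueNumberOn {n} G U w =
  (Σ (Subset n) λ S → IsClique G S × (∀ x → x ∈ S → x ∈ U) × ∣ S ∣ ≡ w)
  × (∀ S → IsClique G S → (∀ x → x ∈ S → x ∈ U) → ∣ S ∣ ≤ w)

CliqueNumber : ∀ {n} → Graph n → ℕ → Set
CliqueNumber {n} G w =
  (Σ (Subset n) λ S → IsClique G S × ∣ S ∣ ≡ w)
  × (∀ S → IsClique G S → ∣ S ∣ ≤ w)

ProperColouring : ∀ {n} → Graph n → (c : ℕ) → (Fin n → Fin c) → Set
ProperColouring G c f = ∀ x y → Adj G x y → f x ≢ f y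

ChromaticAtMost : ∀ {n} → Graph n → ℕ → Set
ChromaticAtMost {n} G c = Σ (Fin n → Fin c) λ f → ProperColouring G c f

-- A vertex h outside the maximum clique A has at most one neighbour in A: two
-- neighbours a, b and a non-neighbour c ∈ A span a diamond, and a vertex complete
-- to A would enlarge it. Rank the vertices of A by 0, …, ω − 1, put t = min(k, ω − 2),
-- and split H into Y, the vertices with a neighbour of rank < t, and X, the rest.
-- Both are P4-free, because an induced P4 anticomplete to an edge is an induced
-- P2 ∪ P4: Y misses the edge of ranks t, t + 1, and X (which has an edge only if
-- k ≥ 2, hence t ≥ 2) misses the edge of ranks 0, 1. In a P4-free graph every
-- greedy colouring is optimal: a vertex of colour c lies on a clique carrying the
-- colours 0, …, c. So Y is coloured from [0, k) and X from [k, 2k). Finally A is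
-- coloured injectively by rotating the ranks in [0, t + k) by k: the ranks below t,
-- the only neighbours of Y, land in [k, 2k), and all other ranks avoid [k, 2k).

module Submission where

open import Defs hiding (sym)
open import Data.Nat using (ℕ; zero; suc; _+_; _∸_; _≤_; _<_; _⊔_; _*_; z≤n; s≤s; _<?_)
open import Data.Nat.Properties
open import Data.Fin as F using (Fin; zero; suc; toℕ; fromℕ<; #_)
open import Data.Fin.Properties using (all?; any?; toℕ-fromℕ<)
open import Data.Fin.Subset using (Subset; _∈_; _∉_; _⊂_; ∣_∣; ∁; ⁅_⁆; _∪_; ⊥; inside; outside)
open import Data.Fin.Subset.Properties
  using (_∈?_; ∉⊥; x∈⁅x⁆; x∈⁅y⁆⇒x≡y; x∈p∪q⁻; x∈p∪q⁺; q⊆p∪q; p⊂q⇒∣p∣<∣q∣; x∉p⇒x∈∁p)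
open import Data.Vec as Vec using ([]; _∷_; here; there)
open import Data.Vec.Functional using (updateAt)
open import Data.Vec.Functional.Properties using (updateAt-updates; updateAt-minimal)
open import Data.Bool using (Bool; true; false; T)
import Data.Bool.Properties as Bool
open import Data.Bool.Properties using (T-≡; ¬-not; T?)
open import Data.List as L using (List; []; _∷_; _++_; length)
open import Data.List.Membership.Propositional using () renaming (_∈_ to _∈ₗ_; _∉_ to _∉ₗ_)
open import Data.List.Membership.Propositional.Properties using (∈-map⁺; ∈-map⁻; ∈-filter⁺; ∈-filter⁻; ∈-allFin)
open import Data.List.Relation.Unary.Any as Any using (here; there)
open import Data.List.Relation.Unary.All as All using (All; []; _∷_)
open import Data.List.Relation.Unary.All.Properties using (++⁻; map⁻; tabulate⁻)
open import Data.List.Relation.Unary.AllPairs as AllPairs using (AllPairs; []; _∷_)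
open import Data.List.Relation.Unary.Unique.Propositional using (Unique)
open import Data.List.Extrema.Nat using (max; xs≤max)
import Data.Product as Product
open import Data.Product using (Σ; ∃; ∃₂; _×_; _,_; proj₁; proj₂)
open import Data.Sum using (_⊎_; inj₁; inj₂; [_,_]′)
open import Data.Empty using (⊥-elim)
open import Function using (_∘_; const; id)
open import Function.Bundles using (Equivalence)
open import Relation.Nullary using (¬_; Dec; yes; no)
open import Relation.Nullary.Decidable using (from-yes; decidable-stable; ¬?; _→-dec_; _×-dec_; _⊎-dec_)
open import Relation.Unary using (Decidable)
open import Relation.Binary.PropositionalEquality using (_≡_; _≢_; refl; sym; trans; cong; subst)

-- Induced copies of a pattern graph

Preserves : ∀ {m n} → (Fin m → Fin m → Bool) → Graph n → (Fin m → Fin n) → Set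
Preserves h G f = ∀ x y → adj G (f x) (f y) ≡ h x y

upperPairs : ∀ m → List (Fin m × Fin m)
upperPairs zero    = []
upperPairs (suc m) = L.tabulate (λ j → zero , suc j) ++ L.map (Product.map suc suc) (upperPairs m)

PreservesUpper : ∀ {m n} → (Fin m → Fin m → Bool) → Graph n → (Fin m → Fin n) → Set
PreservesUpper {m} h G f = All (λ (x , y) → adj G (f x) (f y) ≡ h x y) (upperPairs m)

preserves-upperPairs : ∀ {m n} {h : Fin m → Fin m → Bool} (G : Graph n) (f : Fin m → Fin n) →
  (∀ x y → h x y ≡ h y x) → (∀ x → h x x ≡ false) → PreservesUpper h G f → Preserves h G f
preserves-upperPairs {suc m} G f h-sym h-irr upper with ++⁻ (L.tabulate (λ j → zero , suc j)) upper
... | row , rest = preserves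
  where
  preserves : Preserves _ G f
  preserves zero    zero    = trans (irrefl G (f zero)) (sym (h-irr zero))
  preserves zero    (suc j) = tabulate⁻ row j
  preserves (suc i) zero    = trans (Graph.sym G _ _) (trans (tabulate⁻ row i) (h-sym zero (suc i)))
  preserves (suc i) (suc j) =
    preserves-upperPairs G (f ∘ suc) (λ x y → h-sym (suc x) (suc y)) (h-irr ∘ suc) (map⁻ rest) i j

Twins : ∀ {m} → (Fin m → Fin m → Bool) → Fin m → Fin m → Set
Twins h x y = ∀ z → h x z ≡ h y z

twins? : ∀ {m} (h : Fin m → Fin m → Bool) x y → Dec (Twins h x y)
twins? h x y = all? λ z → h x z Bool.≟ h y z

-- An adjacency-preserving map can only identify twins of the pattern, so injectivity
-- needs checking on twins only: P2 ∪ P4 has none, the diamond only the ends of its non-edge.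
preserves-twins : ∀ {m n} {h : Fin m → Fin m → Bool} {G : Graph n} {f : Fin m → Fin n} →
  Preserves h G f → ∀ {x y} → f x ≡ f y → Twins h x y
preserves-twins {G = G} {f} pres {x} {y} fx≡fy z =
  trans (sym (pres x z)) (trans (cong (λ v → adj G v (f z)) fx≡fy) (pres y z))

induced-from-upperPairs : ∀ {m n} {h : Fin m → Fin m → Bool} (G : Graph n) (f : Fin m → Fin n) →
  (∀ x y → h x y ≡ h y x) → (∀ x → h x x ≡ false) → PreservesUpper h G f →
  (∀ {x y} → Twins h x y → f x ≡ f y → x ≡ y) → InducedSub h G
induced-from-upperPairs G f h-sym h-irr upper separate =
  f , (λ fx≡fy → separate (preserves-twins {G = G} preserves fx≡fy) fx≡fy) , preserves
  where
  preserves : Preserves _ G f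
  preserves = preserves-upperPairs G f h-sym h-irr upper

P2∪P4-sym : ∀ x y → P2∪P4 x y ≡ P2∪P4 y x
P2∪P4-sym = from-yes (all? λ x → all? λ y → P2∪P4 x y Bool.≟ P2∪P4 y x)

P2∪P4-irrefl : ∀ x → P2∪P4 x x ≡ false
P2∪P4-irrefl = from-yes (all? λ x → P2∪P4 x x Bool.≟ false)

P2∪P4-twin-free : ∀ x y → Twins P2∪P4 x y → x ≡ y
P2∪P4-twin-free = from-yes (all? λ x → all? λ y → twins? P2∪P4 x y →-dec x F.≟ y)

Diamond-sym : ∀ x y → Diamond x y ≡ Diamond y x
Diamond-sym = from-yes (all? λ x → all? λ y → Diamond x y Bool.≟ Diamond y x)

Diamond-irrefl : ∀ x → Diamond x x ≡ false
Diamond-irrefl = from-yes (all? λ x → Diamond x x Bool.≟ false)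

Diamond-twins : ∀ x y → Twins Diamond x y → x ≡ y ⊎ (x ≡ # 2 × y ≡ # 3) ⊎ (x ≡ # 3 × y ≡ # 2)
Diamond-twins = from-yes (all? λ x → all? λ y → twins? Diamond x y →-dec
  (x F.≟ y ⊎-dec ((x F.≟ # 2 ×-dec y F.≟ # 3) ⊎-dec (x F.≟ # 3 ×-dec y F.≟ # 2))))

-- Cliques and ranks inside a vertex subset

fromList : ∀ {n} → List (Fin n) → Subset n
fromList = L.foldr (λ x S → ⁅ x ⁆ ∪ S) ⊥

∈-fromList⁻ : ∀ {n} {y : Fin n} xs → y ∈ fromList xs → y ∈ₗ xs
∈-fromList⁻ []       y∈ = ⊥-elim (∉⊥ y∈)
∈-fromList⁻ (x ∷ xs) y∈ with x∈p∪q⁻ ⁅ x ⁆ (fromList xs) y∈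
... | inj₁ y∈⁅x⁆ = here (x∈⁅y⁆⇒x≡y x y∈⁅x⁆)
... | inj₂ y∈xs  = there (∈-fromList⁻ xs y∈xs)

length≤∣fromList∣ : ∀ {n} (xs : List (Fin n)) → Unique xs → length xs ≤ ∣ fromList xs ∣
length≤∣fromList∣ []       []               = z≤n
length≤∣fromList∣ (x ∷ xs) (x∉xs ∷ unique) =
  ≤-trans (s≤s (length≤∣fromList∣ xs unique)) (p⊂q⇒∣p∣<∣q∣ (q⊆p∪q ⁅ x ⁆ (fromList xs) , x , x∈ , x∉))
  where
  x∈ : x ∈ ⁅ x ⁆ ∪ fromList xs
  x∈ = x∈p∪q⁺ (inj₁ (x∈⁅x⁆ x))
  x∉ : x ∉ fromList xs
  x∉ x∈xs = All.lookup x∉xs (∈-fromList⁻ xs x∈xs) refl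

-- The number of elements of p below x; meaningless when x ∉ p.
rank : ∀ {n} → Subset n → Fin n → ℕ
rank (_       ∷ _) zero    = 0
rank (inside  ∷ p) (suc x) = suc (rank p x)
rank (outside ∷ p) (suc x) = rank p x

rank<∣p∣ : ∀ {n} {p : Subset n} {x} → x ∈ p → rank p x < ∣ p ∣
rank<∣p∣ {p = inside  ∷ p} here        = s≤s z≤n
rank<∣p∣ {p = inside  ∷ p} (there x∈p) = s≤s (rank<∣p∣ x∈p)
rank<∣p∣ {p = outside ∷ p} (there x∈p) = rank<∣p∣ x∈p

rank-injective : ∀ {n} {p : Subset n} {x y} → x ∈ p → y ∈ p → rank p x ≡ rank p y → x ≡ y
rank-injective {p = inside  ∷ p} here        here        _  = refl
rank-injective {p = inside  ∷ p} (there x∈p) (there y∈p) eq = cong suc (rank-injective x∈p y∈p (suc-injective eq))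
rank-injective {p = outside ∷ p} (there x∈p) (there y∈p) eq = cong suc (rank-injective x∈p y∈p eq)

rank-surjective : ∀ {n} (p : Subset n) {i} → i < ∣ p ∣ → ∃ λ x → x ∈ p × rank p x ≡ i
rank-surjective (inside  ∷ p) {zero}  _         = zero , here , refl
rank-surjective (inside  ∷ p) {suc i} (s≤s i<) with rank-surjective p i<
... | x , x∈p , refl = suc x , there x∈p , refl
rank-surjective (outside ∷ p) i< with rank-surjective p i<
... | x , x∈p , refl = suc x , there x∈p , refl

-- Greedy colourings of P4-free graphs

mex : (xs : List ℕ) → ∃ λ m → m ∉ₗ xs × (∀ {c} → c < m → c ∈ₗ xs)
mex xs = search (suc (max 0 xs)) 0 (λ ()) (λ x∈xs → s≤s (All.lookup (xs≤max 0 xs) x∈xs))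
  where
  search : ∀ b s → (∀ {c} → c < s → c ∈ₗ xs) → (∀ {x} → x ∈ₗ xs → x < s + b) →
           ∃ λ m → m ∉ₗ xs × (∀ {c} → c < m → c ∈ₗ xs)
  search b s below bounded with Any.any? (s ≟_) xs
  ... | no s∉xs = s , s∉xs , below
  search zero    s below bounded | yes s∈xs = ⊥-elim (n≮n s (subst (s <_) (+-identityʳ s) (bounded s∈xs)))
  search (suc b) s below bounded | yes s∈xs = search b (suc s) below′ bounded′
    where
    bounded′ : ∀ {x} → x ∈ₗ xs → x < suc s + b
    bounded′ {x} x∈xs = subst (x <_) (+-suc s b) (bounded x∈xs)

    below′ : ∀ {c} → c < suc s → c ∈ₗ xs
    below′ c<1+s with m<1+n⇒m<n∨m≡n c<1+s
    ... | inj₁ c<s  = below c<s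
    ... | inj₂ refl = s∈xs

module _ {n} (G : Graph n) where

  Adj-sym : ∀ {x y} → Adj G x y → Adj G y x
  Adj-sym {x} {y} = subst T (Graph.sym G x y)

  Adj-irrefl : ∀ {x} → ¬ Adj G x x
  Adj-irrefl {x} = subst T (irrefl G x)

  Adj⇒≢ : ∀ {x y} → Adj G x y → x ≢ y
  Adj⇒≢ xy refl = Adj-irrefl xy

  adj≡true : ∀ {x y} → Adj G x y → adj G x y ≡ true
  adj≡true = Equivalence.to T-≡

  adj≡false : ∀ {x y} → ¬ Adj G x y → adj G x y ≡ false
  adj≡false ¬xy = ¬-not (¬xy ∘ Equivalence.from T-≡)

  record IsP4 (a b c d : Fin n) : Set where
    field
      ab  : Adj G a b
      bc  : Adj G b c
      cd  : Adj G c d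
      ¬ac : ¬ Adj G a c
      ¬bd : ¬ Adj G b d
      ¬ad : ¬ Adj G a d

  P4FreeOn : (Fin n → Set) → Set
  P4FreeOn P = ∀ {a b c d} → P a → P b → P c → P d → ¬ IsP4 a b c d

  diamond : ∀ {a b c d} → Adj G a b → Adj G a c → Adj G a d → Adj G b c → Adj G b d →
            ¬ Adj G c d → c ≢ d → InducedSub Diamond G
  diamond {a} {b} {c} {d} ab ac ad bc bd ¬cd c≢d =
    induced-from-upperPairs G f Diamond-sym Diamond-irrefl
      (adj≡true ab ∷ adj≡true ac ∷ adj≡true ad ∷ adj≡true bc ∷ adj≡true bd ∷ adj≡false ¬cd ∷ [])
      separate
    where
    f : Fin 4 → Fin n
    f = Vec.lookup (a ∷ b ∷ c ∷ d ∷ [])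
    separate : ∀ {x y} → Twins Diamond x y → f x ≡ f y → x ≡ y
    separate {x} {y} twins fx≡fy with Diamond-twins x y twins
    ... | inj₁ x≡y                  = x≡y
    ... | inj₂ (inj₁ (refl , refl)) = ⊥-elim (c≢d fx≡fy)
    ... | inj₂ (inj₂ (refl , refl)) = ⊥-elim (c≢d (sym fx≡fy))

  anticomplete-to-edge⇒P4-free : Free P2∪P4 G → ∀ {P : Fin n → Set} {u v} → Adj G u v →
    (∀ {x} → P x → ¬ Adj G u x × ¬ Adj G v x) → P4FreeOn P
  anticomplete-to-edge⇒P4-free P2∪P4-free {P} {u} {v} uv far {a} {b} {c} {d} pa pb pc pd p4 =
    P2∪P4-free (induced-from-upperPairs G (Vec.lookup (u ∷ v ∷ a ∷ b ∷ c ∷ d ∷ [])) P2∪P4-sym P2∪P4-irrefl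
      (adj≡true uv ∷ u≁ pa ∷ u≁ pb ∷ u≁ pc ∷ u≁ pd ∷ v≁ pa ∷ v≁ pb ∷ v≁ pc ∷ v≁ pd ∷
       adj≡true ab ∷ adj≡false ¬ac ∷ adj≡false ¬ad ∷ adj≡true bc ∷ adj≡false ¬bd ∷ adj≡true cd ∷ [])
      (λ twins _ → P2∪P4-twin-free _ _ twins))
    where
    open IsP4 p4
    u≁ : ∀ {x} → P x → adj G u x ≡ false
    u≁ = adj≡false ∘ proj₁ ∘ far
    v≁ : ∀ {x} → P x → adj G v x ≡ false
    v≁ = adj≡false ∘ proj₂ ∘ far

  clique-lookup : ∀ {Q x y} → AllPairs (Adj G) Q → x ∈ₗ Q → y ∈ₗ Q → x ≢ y → Adj G x y
  clique-lookup _              (here refl) (here refl) x≢y = ⊥-elim (x≢y refl)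
  clique-lookup (x-adj ∷ _)    (here refl) (there y∈Q) _   = All.lookup x-adj y∈Q
  clique-lookup (y-adj ∷ _)    (there x∈Q) (here refl) _   = Adj-sym (All.lookup y-adj x∈Q)
  clique-lookup (_ ∷ clique)   (there x∈Q) (there y∈Q) x≢y = clique-lookup clique x∈Q y∈Q x≢y

  clique-length≤ : ∀ {U k} → CliqueNumberOn G U k → ∀ {Q} → AllPairs (Adj G) Q → All (_∈ U) Q → length Q ≤ k
  clique-length≤ (_ , bound) {Q} clique Q⊆U =
    ≤-trans (length≤∣fromList∣ Q (AllPairs.map Adj⇒≢ clique))
            (bound (fromList Q) (λ x y x∈ y∈ → clique-lookup clique (∈-fromList⁻ Q x∈) (∈-fromList⁻ Q y∈))
                   (λ x x∈ → All.lookup Q⊆U (∈-fromList⁻ Q x∈)))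

  maximum-clique-non-neighbour : ∀ {ω A h} → CliqueNumber G ω → IsClique G A → ∣ A ∣ ≡ ω → h ∉ A →
    ∃ λ c → c ∈ A × ¬ Adj G h c
  maximum-clique-non-neighbour {ω} {A} {h} ω-max A-clique ∣A∣≡ω h∉A
    with any? (λ c → c ∈? A ×-dec ¬? (T? (adj G h c)))
  ... | yes found = found
  ... | no none   =
    ⊥-elim (<⇒≱ (p⊂q⇒∣p∣<∣q∣ A⊂hA) (subst (_ ≤_) (sym ∣A∣≡ω) (proj₂ ω-max (⁅ h ⁆ ∪ A) hA-clique)))
    where
    complete : ∀ c → c ∈ A → Adj G h c
    complete c c∈A = decidable-stable (T? _) λ ¬hc → none (c , c∈A , ¬hc)
    A⊂hA : A ⊂ ⁅ h ⁆ ∪ A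
    A⊂hA = q⊆p∪q ⁅ h ⁆ A , h , x∈p∪q⁺ (inj₁ (x∈⁅x⁆ h)) , h∉A
    hA-clique : IsClique G (⁅ h ⁆ ∪ A)
    hA-clique x y x∈ y∈ x≢y with x∈p∪q⁻ ⁅ h ⁆ A x∈ | x∈p∪q⁻ ⁅ h ⁆ A y∈
    ... | inj₁ x∈⁅h⁆ | inj₁ y∈⁅h⁆ = ⊥-elim (x≢y (trans (x∈⁅y⁆⇒x≡y h x∈⁅h⁆) (sym (x∈⁅y⁆⇒x≡y h y∈⁅h⁆))))
    ... | inj₁ x∈⁅h⁆ | inj₂ y∈A   = subst (λ z → Adj G z y) (sym (x∈⁅y⁆⇒x≡y h x∈⁅h⁆)) (complete y y∈A)
    ... | inj₂ x∈A   | inj₁ y∈⁅h⁆ = subst (Adj G x) (sym (x∈⁅y⁆⇒x≡y h y∈⁅h⁆)) (Adj-sym (complete x x∈A))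
    ... | inj₂ x∈A   | inj₂ y∈A   = A-clique x y x∈A y∈A x≢y

  ProperOn : (Fin n → Set) → (Fin n → ℕ) → Set
  ProperOn P f = ∀ {u w} → P u → P w → Adj G u w → f u ≢ f w

  record GrundyOn (P : Fin n → Set) (f : Fin n → ℕ) : Set where
    field
      proper     : ProperOn P f
      sees-lower : ∀ {u} → P u → ∀ {c} → c < f u → ∃ λ w → P w × Adj G u w × f w ≡ c

  GrundyOn-resp : ∀ {P Q f} → (∀ {x} → P x → Q x) → (∀ {x} → Q x → P x) → GrundyOn Q f → GrundyOn P f
  GrundyOn-resp P⇒Q Q⇒P grundy = record
    { proper     = λ pu pw → proper (P⇒Q pu) (P⇒Q pw)
    ; sees-lower = λ pu c< → Product.map₂ (Product.map₁ Q⇒P) (sees-lower (P⇒Q pu) c<)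
    }
    where open GrundyOn grundy

  grundy-extend : ∀ {D f v} → GrundyOn (_∈ₗ D) f → v ∉ₗ D → ∃ (GrundyOn (_∈ₗ v ∷ D))
  grundy-extend {D} {f} {v} grundy v∉D with mex (L.map f (L.filter (T? ∘ adj G v) D))
  ... | m , m∉ , below = f′ , record { proper = proper′ ; sees-lower = sees-lower′ }
    where
    open GrundyOn grundy
    f′ : Fin n → ℕ
    f′ = updateAt f v (const m)

    f′-new : f′ v ≡ m
    f′-new = updateAt-updates v f

    f′-old : ∀ {u} → u ∈ₗ D → f′ u ≡ f u
    f′-old u∈D = updateAt-minimal _ v f λ { refl → v∉D u∈D }

    new≢old : ∀ {w} → w ∈ₗ D → Adj G v w → f′ v ≢ f′ w
    new≢old w∈D vw eq =
      m∉ (subst (_∈ₗ _) (trans (sym (f′-old w∈D)) (trans (sym eq) f′-new))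
                (∈-map⁺ f (∈-filter⁺ (T? ∘ adj G v) w∈D vw)))

    proper′ : ProperOn (_∈ₗ v ∷ D) f′
    proper′ (here refl) (here refl) vv    = ⊥-elim (Adj-irrefl vv)
    proper′ (here refl) (there w∈D) vw    = new≢old w∈D vw
    proper′ (there u∈D) (here refl) uv    = new≢old u∈D (Adj-sym uv) ∘ sym
    proper′ (there u∈D) (there w∈D) uw eq = proper u∈D w∈D uw (trans (sym (f′-old u∈D)) (trans eq (f′-old w∈D)))

    sees-lower′ : ∀ {u} → u ∈ₗ v ∷ D → ∀ {c} → c < f′ u → ∃ λ w → w ∈ₗ v ∷ D × Adj G u w × f′ w ≡ c
    sees-lower′ (here refl) c< with ∈-map⁻ f (below (subst (_ <_) f′-new c<))
    ... | w , w∈ , c≡fw with ∈-filter⁻ (T? ∘ adj G v) w∈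
    ...   | w∈D , vw = w , there w∈D , vw , trans (f′-old w∈D) (sym c≡fw)
    sees-lower′ (there u∈D) c< with sees-lower u∈D (subst (_ <_) (f′-old u∈D) c<)
    ... | w , w∈D , uw , fw≡c = w , there w∈D , uw , trans (f′-old w∈D) fw≡c

  grundy-colouring : (D : List (Fin n)) → ∃ (GrundyOn (_∈ₗ D))
  grundy-colouring []      = const 0 , record { proper = λ () ; sees-lower = λ () }
  grundy-colouring (v ∷ D) with grundy-colouring D | Any.any? (v F.≟_) D
  ... | f , grundy | yes v∈D = f , GrundyOn-resp drop-v there grundy
    where
    drop-v : ∀ {u} → u ∈ₗ v ∷ D → u ∈ₗ D
    drop-v (here refl) = v∈D
    drop-v (there u∈D) = u∈D
  ... | f , grundy | no v∉D  = grundy-extend grundy v∉D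

  module _ {P : Fin n → Set} {f : Fin n → ℕ} (grundy : GrundyOn P f) (P4-free : P4FreeOn P) where
    open GrundyOn grundy

    common-neighbour-of-colour : ∀ c q Q → AllPairs (Adj G) (q ∷ Q) → All P (q ∷ Q) →
      All (λ x → c < f x) (q ∷ Q) → ∃ λ w → P w × f w ≡ c × All (Adj G w) (q ∷ Q)
    common-neighbour-of-colour c q [] _ (pq ∷ []) (c<q ∷ []) with sees-lower pq c<q
    ... | w , pw , qw , fw≡c = w , pw , fw≡c , Adj-sym qw ∷ []
    common-neighbour-of-colour c q (q′ ∷ Q) (q-adj ∷ clique) (pq ∷ ps) (c<q ∷ cs)
      with common-neighbour-of-colour c q′ Q clique ps cs
    ... | w , pw , fw≡c , w-adj with T? (adj G w q)
    ...   | yes wq = w , pw , fw≡c , wq ∷ w-adj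
    ...   | no ¬wq with sees-lower pq c<q
    ...     | w′ , pw′ , qw′ , fw′≡c = w′ , pw′ , fw′≡c , Adj-sym qw′ ∷ All.tabulate w′-adj
      where
      -- w misses q, so use a neighbour w′ of q of colour c instead: a vertex x missed by w′
      -- would make w x q w′ an induced P4, as w and w′ share a colour.
      w′-adj : ∀ {x} → x ∈ₗ q′ ∷ Q → Adj G w′ x
      w′-adj {x} x∈ = decidable-stable (T? _) λ ¬w′x → P4-free pw (All.lookup ps x∈) pq pw′ record
        { ab  = All.lookup w-adj x∈
        ; bc  = Adj-sym (All.lookup q-adj x∈)
        ; cd  = qw′
        ; ¬ac = ¬wq
        ; ¬bd = ¬w′x ∘ Adj-sym
        ; ¬ad = λ ww′ → proper pw pw′ ww′ (trans fw≡c (sym fw′≡c))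
        }

    rainbow-clique : ∀ {v} → P v → ∀ d j → j + d ≡ f v →
      ∃₂ λ q Q → length Q ≡ d × AllPairs (Adj G) (q ∷ Q) × All P (q ∷ Q) × All (λ x → j ≤ f x) (q ∷ Q)
    rainbow-clique {v} pv zero j j+0≡fv =
      v , [] , refl , [] ∷ [] , pv ∷ [] , ≤-reflexive (trans (sym (+-identityʳ j)) j+0≡fv) ∷ []
    rainbow-clique pv (suc d) j j+d+1≡fv with rainbow-clique pv d (suc j) (trans (sym (+-suc j d)) j+d+1≡fv)
    ... | q , Q , len , clique , ps , above with common-neighbour-of-colour j q Q clique ps above
    ... | w , pw , fw≡j , w-adj =
      w , q ∷ Q , cong suc len , w-adj ∷ clique , pw ∷ ps , ≤-reflexive (sym fw≡j) ∷ All.map <⇒≤ above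

    grundy-colour< : ∀ {k} → (∀ {Q} → AllPairs (Adj G) Q → All P Q → length Q ≤ k) → ∀ {v} → P v → f v < k
    grundy-colour< {k} clique-bound {v} pv with rainbow-clique pv (f v) 0 refl
    ... | q , Q , len , clique , ps , _ = subst (_≤ k) (cong suc len) (clique-bound clique ps)

  P4-free-colouring : ∀ {P : Fin n → Set} {k} → Decidable P → P4FreeOn P →
    (∀ {Q} → AllPairs (Adj G) Q → All P Q → length Q ≤ k) →
    ∃ λ f → (∀ {x} → P x → f x < k) × ProperOn P f
  P4-free-colouring {P} P? P4-free clique-bound with grundy-colouring (L.filter P? (L.allFin n))
  ... | f , grundy = f , grundy-colour< grundyP P4-free clique-bound , GrundyOn.proper grundyP
    where
    grundyP : GrundyOn P f
    grundyP = GrundyOn-resp (λ px → ∈-filter⁺ P? (∈-allFin _) px) (proj₂ ∘ ∈-filter⁻ P? {xs = L.allFin n}) grundy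

  colouring⇒ChromaticAtMost : ∀ {c} (f : Fin n → ℕ) → (∀ x → f x < c) → (∀ {x y} → Adj G x y → f x ≢ f y) →
    ChromaticAtMost G c
  colouring⇒ChromaticAtMost f f<c proper =
    (λ x → fromℕ< (f<c x)) ,
    λ x y xy eq → proper xy (trans (sym (toℕ-fromℕ< (f<c x))) (trans (cong toℕ eq) (toℕ-fromℕ< (f<c y))))

-- The colouring of G

rotate : ℕ → ℕ → ℕ → ℕ
rotate t k r with r <? t | r <? t + k
... | yes _ | _     = k + r
... | no _  | yes _ = r ∸ t
... | no _  | no _  = r

data Rotation (t k r : ℕ) : ℕ → Set where
  up    : r < t → Rotation t k r (k + r)
  down  : t ≤ r → r < t + k → Rotation t k r (r ∸ t)
  fixed : t + k ≤ r → Rotation t k r r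

rotation : ∀ t k r → Rotation t k r (rotate t k r)
rotation t k r with r <? t | r <? t + k
... | yes r<t | _         = up r<t
... | no r≮t  | yes r<t+k = down (≮⇒≥ r≮t) r<t+k
... | no _    | no r≮t+k  = fixed (≮⇒≥ r≮t+k)

module _ (t k : ℕ) where

  private
    down<k : ∀ {r} → t ≤ r → r < t + k → r ∸ t < k
    down<k {r} t≤r r<t+k = subst (r ∸ t <_) (m+n∸m≡n t k) (∸-monoˡ-< r<t+k t≤r)

    up<t+k : ∀ {r} → r < t → k + r < t + k
    up<t+k {r} r<t = subst (k + r <_) (+-comm k t) (+-monoʳ-< k r<t)

    up≢down : ∀ {r r′} → t ≤ r′ → r′ < t + k → k + r ≢ r′ ∸ t
    up≢down {r} t≤r′ r′<t+k eq = <⇒≢ (<-≤-trans (down<k t≤r′ r′<t+k) (m≤m+n k r)) (sym eq)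

    up≢fixed : ∀ {r r′} → r < t → t + k ≤ r′ → k + r ≢ r′
    up≢fixed r<t t+k≤r′ = <⇒≢ (<-≤-trans (up<t+k r<t) t+k≤r′)

    down≢fixed : ∀ {r r′} → t ≤ r → r < t + k → t + k ≤ r′ → r ∸ t ≢ r′
    down≢fixed t≤r r<t+k t+k≤r′ = <⇒≢ (<-≤-trans (down<k t≤r r<t+k) (≤-trans (m≤n+m k t) t+k≤r′))

    rotation-injective : ∀ {r r′ a b} → Rotation t k r a → Rotation t k r′ b → a ≡ b → r ≡ r′
    rotation-injective (up _)          (up _)             eq = +-cancelˡ-≡ k _ _ eq
    rotation-injective (up _)          (down t≤r′ r′<)    eq = ⊥-elim (up≢down t≤r′ r′< eq)
    rotation-injective (up r<t)        (fixed t+k≤r′)     eq = ⊥-elim (up≢fixed r<t t+k≤r′ eq)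
    rotation-injective (down t≤r r<)   (up _)             eq = ⊥-elim (up≢down t≤r r< (sym eq))
    rotation-injective (down t≤r _)    (down t≤r′ _)      eq =
      trans (sym (m∸n+n≡m t≤r)) (trans (cong (_+ t) eq) (m∸n+n≡m t≤r′))
    rotation-injective (down t≤r r<)   (fixed t+k≤r′)     eq = ⊥-elim (down≢fixed t≤r r< t+k≤r′ eq)
    rotation-injective (fixed t+k≤r)   (up r′<t)          eq = ⊥-elim (up≢fixed r′<t t+k≤r (sym eq))
    rotation-injective (fixed t+k≤r)   (down t≤r′ r′<)    eq = ⊥-elim (down≢fixed t≤r′ r′< t+k≤r (sym eq))
    rotation-injective (fixed _)       (fixed _)          eq = eq

  rotate-injective : ∀ {r r′} → rotate t k r ≡ rotate t k r′ → r ≡ r′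
  rotate-injective {r} {r′} = rotation-injective (rotation t k r) (rotation t k r′)

  rotate-low : ∀ {r} → r < t → k ≤ rotate t k r
  rotate-low {r} r<t with rotate t k r | rotation t k r
  ... | _ | up _           = m≤m+n k r
  ... | _ | down t≤r _     = ⊥-elim (<⇒≱ r<t t≤r)
  ... | _ | fixed t+k≤r    = ⊥-elim (<⇒≱ r<t (≤-trans (m≤m+n t k) t+k≤r))

  rotate-high : ∀ {u r} → k ≤ t ⊎ u ≤ t + k → t ≤ r → r < u → rotate t k r < k ⊎ k + k ≤ rotate t k r
  rotate-high {u} {r} k≤t⊎u≤t+k t≤r r<u with rotate t k r | rotation t k r
  ... | _ | up r<t               = ⊥-elim (<⇒≱ r<t t≤r)
  ... | _ | down t≤r r<t+k       = inj₁ (down<k t≤r r<t+k)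
  ... | _ | fixed t+k≤r with k≤t⊎u≤t+k
  ...   | inj₁ k≤t   = inj₂ (≤-trans (+-monoˡ-≤ k k≤t) t+k≤r)
  ...   | inj₂ u≤t+k = ⊥-elim (<⇒≱ r<u (≤-trans u≤t+k t+k≤r))

  rotate-< : ∀ {u r} → t + k ≤ u → r < u → rotate t k r < u
  rotate-< {u} {r} t+k≤u r<u with rotate t k r | rotation t k r
  ... | _ | up r<t         = <-≤-trans (up<t+k r<t) t+k≤u
  ... | _ | down t≤r r<t+k = <-≤-trans (down<k t≤r r<t+k) (≤-trans (m≤n+m k t) t+k≤u)
  ... | _ | fixed _        = r<u

threshold : ∀ {ω} k → 4 ≤ ω → ∃ λ t → t ≤ k × suc t < ω × (2 ≤ k → 2 ≤ t) × (k ≤ t ⊎ ω ≤ t + k)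
threshold {ω} k 4≤ω = choose (k ≤? ω ∸ 2)
  where
  2+[ω∸2]≡ω : 2 + (ω ∸ 2) ≡ ω
  2+[ω∸2]≡ω = m+[n∸m]≡n (≤-trans (s≤s (s≤s z≤n)) 4≤ω)

  2≤ω∸2 : 2 ≤ ω ∸ 2
  2≤ω∸2 = ∸-monoˡ-≤ 2 4≤ω

  choose : Dec (k ≤ ω ∸ 2) → ∃ λ t → t ≤ k × suc t < ω × (2 ≤ k → 2 ≤ t) × (k ≤ t ⊎ ω ≤ t + k)
  choose (yes k≤ω∸2) =
    k , ≤-refl , subst (2 + k ≤_) 2+[ω∸2]≡ω (+-monoʳ-≤ 2 k≤ω∸2) , id , inj₁ ≤-refl
  choose (no k≰ω∸2) =
    ω ∸ 2 , <⇒≤ ω∸2<k , ≤-reflexive 2+[ω∸2]≡ω , const 2≤ω∸2 ,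
    inj₂ (subst (_≤ ω ∸ 2 + k) (trans (+-comm (ω ∸ 2) 2) 2+[ω∸2]≡ω)
                (+-monoʳ-≤ (ω ∸ 2) (<⇒≤ (≤-<-trans 2≤ω∸2 ω∸2<k))))
    where
    ω∸2<k : ω ∸ 2 < k
    ω∸2<k = ≰⇒> k≰ω∸2

module Lemma2p3 {n} (G : Graph n) (ω : ℕ) (P2∪P4-free : Free P2∪P4 G) (diamond-free : Free Diamond G)
  (ω-max : CliqueNumber G ω) (A : Subset n) (A-clique : IsClique G A) (∣A∣≡ω : ∣ A ∣ ≡ ω)
  (k : ℕ) (k-max : CliqueNumberOn G (∁ A) k) where

  A-neighbour-unique : ∀ {h a b} → h ∉ A → a ∈ A → b ∈ A → Adj G h a → Adj G h b → a ≡ b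
  A-neighbour-unique {h} {a} {b} h∉A a∈A b∈A ha hb with a F.≟ b
  ... | yes a≡b = a≡b
  ... | no a≢b with maximum-clique-non-neighbour G ω-max A-clique ∣A∣≡ω h∉A
  ...   | c , c∈A , ¬hc = ⊥-elim (diamond-free (diamond G
            (A-clique a b a∈A b∈A a≢b) (Adj-sym G ha) (A-clique a c a∈A c∈A (λ { refl → ¬hc ha }))
            (Adj-sym G hb) (A-clique b c b∈A c∈A (λ { refl → ¬hc hb }))
            ¬hc (λ { refl → h∉A c∈A })))

  outside-clique-length≤ : ∀ {Q} → AllPairs (Adj G) Q → All (_∉ A) Q → length Q ≤ k
  outside-clique-length≤ clique Q∩A≡∅ = clique-length≤ G k-max clique (All.map x∉p⇒x∈∁p Q∩A≡∅)

  anticomplete-to-ranks⇒P4-free : ∀ {P : Fin n → Set} {i j} → i < j → j < ω →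
    (∀ {x a} → P x → a ∈ A → rank A a ≡ i ⊎ rank A a ≡ j → ¬ Adj G a x) → P4FreeOn G P
  anticomplete-to-ranks⇒P4-free i<j j<ω far
    with rank-surjective A (subst (_ <_) (sym ∣A∣≡ω) (<-trans i<j j<ω))
       | rank-surjective A (subst (_ <_) (sym ∣A∣≡ω) j<ω)
  ... | u , u∈A , rank-u | v , v∈A , rank-v =
    anticomplete-to-edge⇒P4-free G P2∪P4-free (A-clique u v u∈A v∈A u≢v) λ px →
      far px u∈A (inj₁ rank-u) , far px v∈A (inj₂ rank-v)
    where
    u≢v : u ≢ v
    u≢v refl = <⇒≢ i<j (trans (sym rank-u) rank-v)

  module Colouring (t : ℕ) (t≤k : t ≤ k) (t+1<ω : suc t < ω) (2≤k⇒2≤t : 2 ≤ k → 2 ≤ t)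
    (k≤t⊎ω≤t+k : k ≤ t ⊎ ω ≤ t + k) where

    SeesLow : Fin n → Set
    SeesLow h = ∃ λ a → a ∈ A × rank A a < t × Adj G h a

    sees-low? : Decidable SeesLow
    sees-low? h = any? λ a → a ∈? A ×-dec rank A a <? t ×-dec T? (adj G h a)

    Y X : Fin n → Set
    Y h = h ∉ A × SeesLow h
    X h = h ∉ A × ¬ SeesLow h

    Y-misses-high : ∀ {y a} → Y y → a ∈ A → t ≤ rank A a → ¬ Adj G a y
    Y-misses-high (y∉A , a′ , a′∈A , a′<t , ya′) a∈A t≤a ay
      with A-neighbour-unique y∉A a′∈A a∈A ya′ (Adj-sym G ay)
    ... | refl = <⇒≱ a′<t t≤a

    X-misses-low : ∀ {x a} → X x → a ∈ A → rank A a < t → ¬ Adj G a x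
    X-misses-low (_ , ¬sees) a∈A a<t ax = ¬sees (_ , a∈A , a<t , Adj-sym G ax)

    Y-P4-free : P4FreeOn G Y
    Y-P4-free = anticomplete-to-ranks⇒P4-free (n<1+n t) t+1<ω λ y a∈A rank≡ →
      Y-misses-high y a∈A ([ ≤-reflexive ∘ sym , ≤-trans (n≤1+n t) ∘ ≤-reflexive ∘ sym ]′ rank≡)

    X-P4-free : P4FreeOn G X
    X-P4-free xa xb xc xd p4 =
      anticomplete-to-ranks⇒P4-free (n<1+n 0) (<-≤-trans 1<t t≤ω) far xa xb xc xd p4
      where
      1<t : 1 < t
      1<t = 2≤k⇒2≤t (outside-clique-length≤ ((IsP4.ab p4 ∷ []) ∷ [] ∷ []) (proj₁ xa ∷ proj₁ xb ∷ []))
      t≤ω : t ≤ ω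
      t≤ω = <⇒≤ (<-trans (n<1+n t) t+1<ω)
      far : ∀ {x a} → X x → a ∈ A → rank A a ≡ 0 ⊎ rank A a ≡ 1 → ¬ Adj G a x
      far x a∈A (inj₁ rank≡0) = X-misses-low x a∈A (subst (_< t) (sym rank≡0) (<-trans (n<1+n 0) 1<t))
      far x a∈A (inj₂ rank≡1) = X-misses-low x a∈A (subst (_< t) (sym rank≡1) 1<t)

    Y-colouring : ∃ λ f → (∀ {y} → Y y → f y < k) × ProperOn G Y f
    Y-colouring = P4-free-colouring G (λ h → ¬? (h ∈? A) ×-dec sees-low? h) Y-P4-free
      (λ clique ys → outside-clique-length≤ clique (All.map proj₁ ys))

    X-colouring : ∃ λ f → (∀ {x} → X x → f x < k) × ProperOn G X f
    X-colouring = P4-free-colouring G (λ h → ¬? (h ∈? A) ×-dec ¬? (sees-low? h)) X-P4-free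
      (λ clique xs → outside-clique-length≤ clique (All.map proj₁ xs))

    fY : Fin n → ℕ
    fY = proj₁ Y-colouring

    fY<k : ∀ {y} → Y y → fY y < k
    fY<k = proj₁ (proj₂ Y-colouring)

    fY-proper : ProperOn G Y fY
    fY-proper = proj₂ (proj₂ Y-colouring)

    fX : Fin n → ℕ
    fX = proj₁ X-colouring

    fX<k : ∀ {x} → X x → fX x < k
    fX<k = proj₁ (proj₂ X-colouring)

    fX-proper : ProperOn G X fX
    fX-proper = proj₂ (proj₂ X-colouring)

    data Part (v : Fin n) : Set where
      in-A : v ∈ A → Part v
      in-Y : Y v → Part v
      in-X : X v → Part v

    part : ∀ v → Part v
    part v with v ∈? A | sees-low? v
    ... | yes v∈A | _        = in-A v∈A
    ... | no v∉A  | yes sees = in-Y (v∉A , sees)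
    ... | no v∉A  | no ¬sees = in-X (v∉A , ¬sees)

    colour-of : ∀ {v} → Part v → ℕ
    colour-of {v} (in-A _) = rotate t k (rank A v)
    colour-of {v} (in-Y _) = fY v
    colour-of {v} (in-X _) = k + fX v

    colour : Fin n → ℕ
    colour v = colour-of (part v)

    k+k≤2k⊔ω : k + k ≤ 2 * k ⊔ ω
    k+k≤2k⊔ω = subst (_≤ 2 * k ⊔ ω) (cong (k +_) (+-identityʳ k)) (m≤m⊔n (2 * k) ω)

    colour-of<2k⊔ω : ∀ {v} (p : Part v) → colour-of p < 2 * k ⊔ ω
    colour-of<2k⊔ω (in-A v∈A) = rotate-< t k (≤-trans (+-monoˡ-≤ k t≤k) k+k≤2k⊔ω)
                                         (<-≤-trans (subst (_ <_) ∣A∣≡ω (rank<∣p∣ v∈A)) (m≤n⊔m (2 * k) ω))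
    colour-of<2k⊔ω (in-Y y)   = <-≤-trans (fY<k y) (≤-trans (m≤m+n k k) k+k≤2k⊔ω)
    colour-of<2k⊔ω (in-X x)   = <-≤-trans (+-monoʳ-< k (fX<k x)) k+k≤2k⊔ω

    A-Y-apart : ∀ {a y} → a ∈ A → Y y → Adj G a y → rotate t k (rank A a) ≢ fY y
    A-Y-apart a∈A y ay eq =
      <⇒≱ (fY<k y) (subst (k ≤_) eq (rotate-low t k (≰⇒> λ t≤a → Y-misses-high y a∈A t≤a ay)))

    A-X-apart : ∀ {a x} → a ∈ A → X x → Adj G a x → rotate t k (rank A a) ≢ k + fX x
    A-X-apart {a} a∈A x ax eq with rotate-high t k k≤t⊎ω≤t+k t≤a (subst (_ <_) ∣A∣≡ω (rank<∣p∣ a∈A))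
      where
      t≤a : t ≤ rank A a
      t≤a = ≮⇒≥ λ a<t → X-misses-low x a∈A a<t ax
    ... | inj₁ rot<k   = <⇒≱ rot<k (subst (k ≤_) (sym eq) (m≤m+n k _))
    ... | inj₂ k+k≤rot = <⇒≱ (+-monoʳ-< k (fX<k x)) (subst (k + k ≤_) eq k+k≤rot)

    Y-X-apart : ∀ {y x} → Y y → X x → fY y ≢ k + fX x
    Y-X-apart y x = <⇒≢ (<-≤-trans (fY<k y) (m≤m+n k _))

    colour-of-proper : ∀ {u v} (p : Part u) (q : Part v) → Adj G u v → colour-of p ≢ colour-of q
    colour-of-proper (in-A u∈A) (in-A v∈A) uv = Adj⇒≢ G uv ∘ rank-injective u∈A v∈A ∘ rotate-injective t k
    colour-of-proper (in-A u∈A) (in-Y v)   uv = A-Y-apart u∈A v uv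
    colour-of-proper (in-A u∈A) (in-X v)   uv = A-X-apart u∈A v uv
    colour-of-proper (in-Y u)   (in-A v∈A) uv = A-Y-apart v∈A u (Adj-sym G uv) ∘ sym
    colour-of-proper (in-Y u)   (in-Y v)   uv = fY-proper u v uv
    colour-of-proper (in-Y u)   (in-X v)   uv = Y-X-apart u v
    colour-of-proper (in-X u)   (in-A v∈A) uv = A-X-apart v∈A u (Adj-sym G uv) ∘ sym
    colour-of-proper (in-X u)   (in-Y v)   uv = Y-X-apart v u ∘ sym
    colour-of-proper (in-X u)   (in-X v)   uv = fX-proper u v uv ∘ +-cancelˡ-≡ k _ _

    χ≤2k⊔ω : ChromaticAtMost G (2 * k ⊔ ω)
    χ≤2k⊔ω = colouring⇒ChromaticAtMost G colour (colour-of<2k⊔ω ∘ part)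
               λ {u} {v} → colour-of-proper (part u) (part v)

lemma2p3 : ∀ {n} (G : Graph n) (ω : ℕ) →
    Free P2∪P4 G → Free Diamond G →
    CliqueNumber G ω → 4 ≤ ω →
    (A : Subset n) → IsClique G A → ∣ A ∣ ≡ ω →
    Σ (Fin n) (λ v → v ∉ A) →
    (k : ℕ) → CliqueNumberOn G (∁ A) k →
    ChromaticAtMost G ((2 * k) ⊔ ω)
lemma2p3 G ω P2∪P4-free diamond-free ω-max 4≤ω A A-clique ∣A∣≡ω _ k k-max with threshold k 4≤ω
... | t , t≤k , t+1<ω , 2≤k⇒2≤t , k≤t⊎ω≤t+k = Colouring.χ≤2k⊔ω t t≤k t+1<ω 2≤k⇒2≤t k≤t⊎ω≤t+k
  where open Lemma2p3 G ω P2∪P4-free diamond-free ω-max A A-clique ∣A∣≡ω k k-max
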